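{- Let $\mathbb{K}$ be a field of characteristic zero and let $f=\sum_{n\geq0}f_nx^n$, $g=\sum_{n\geq0}g_nx^n\in\mathbb{K}[[x]]$ with $f_0\neq0$, $g_0\neq0$. Let $(p_n(x))_{n\in\mathbb{N}}$ be the family of polynomials associated to $T(f\mid g)$. (a) If $(q_n(x))_{n\in\mathbb{N}}$ is the family associated to $T(fg\mid g)$, then $q_0(x)=f_0$ and $q_n(x)=xp_{n-1}(x)+f_n$ for $n\geq1$. (b) If $(r_n(x))_{n\in\mathbb{N}}$ is the family associated to $T\!\left(\frac{f}{g}\,\Big|\, g\right)$, then $r_{n-1}(x)=\frac{p_n(x)-p_n(0)}{x}$ for $n\geq1$.
   Context: For $f,g\in\mathbb{K}[[x]]$ with $g(0)\neq0$, $T(f\mid g)$ is the infinite lower triangular matrix whose $k$-th column has generating function $\frac{f(x)}{g(x)}\left(\frac{x}{g(x)}\right)^k$. The associated family of polynomials of a lower triangular matrix $(a_{n,j})$ is $p_n(x)=\sum_{j=0}^n a_{n,j}x^j$. -}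

module Defs where

open import Level using (Level; _⊔_) renaming (suc to lsuc)
open import Algebra.Bundles using (CommutativeRing)
open import Data.Nat using (ℕ; zero; suc; _≤ᵇ_; _∸_)
open import Data.Bool using (if_then_else_)
open import Data.List using (List; []; _∷_)
open import Relation.Nullary using (¬_)
open import Relation.Binary.PropositionalEquality using (_≢_)

record Field (c ℓ : Level) : Set (lsuc (c ⊔ ℓ)) where
  field
    commutativeRing : CommutativeRing c ℓ
  open CommutativeRing commutativeRing public
  field
    0≉1   : ¬ (0# ≈ 1#)
    inv   : (x : Carrier) → ¬ (x ≈ 0#) → Carrier
    inv-r : (x : Carrier) (p : ¬ (x ≈ 0#)) → (x * inv x p) ≈ 1#

module FieldTheory {c ℓ : Level} (K : Field c ℓ) where
  open Field K

  natCast : ℕ → Carrier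
  natCast zero    = 0#
  natCast (suc n) = 1# + natCast n

  CharZero : Set ℓ
  CharZero = ∀ (n : ℕ) → n ≢ 0 → ¬ (natCast n ≈ 0#)

  PS : Set c
  PS = ℕ → Carrier

  sumTo : ℕ → (ℕ → Carrier) → Carrier
  sumTo zero    h = h 0
  sumTo (suc n) h = sumTo n h + h (suc n)

  _·_ : PS → PS → PS
  (f · g) n = sumTo n (λ i → f i * g (n ∸ i))

  oneS : PS
  oneS zero    = 1#
  oneS (suc _) = 0#

  xS : PS
  xS (suc zero) = 1#
  xS _          = 0#

  _^S_ : PS → ℕ → PS
  h ^S zero  = oneS
  h ^S suc k = h · (h ^S k)

  dot : PS → ℕ → List Carrier → Carrier
  dot g i []       = 0#
  dot g i (h ∷ hs) = g i * h + dot g (suc i) hs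

  -- list [h_n, ..., h_0] of the coefficients of 1/g, where
  -- h_0 = g_0⁻¹ and h_n = - g_0⁻¹ Σ_{i=1}^{n} g_i h_{n-i}
  invUpTo : (g : PS) → ¬ (g 0 ≈ 0#) → ℕ → List Carrier
  invUpTo g p zero    = inv (g 0) p ∷ []
  invUpTo g p (suc n) =
    (- (inv (g 0) p * dot g 1 (invUpTo g p n))) ∷ invUpTo g p n

  headOr0 : List Carrier → Carrier
  headOr0 []      = 0#
  headOr0 (h ∷ _) = h

  invS : (g : PS) → ¬ (g 0 ≈ 0#) → PS
  invS g p n = headOr0 (invUpTo g p n)

  T : PS → (g : PS) → ¬ (g 0 ≈ 0#) → ℕ → ℕ → Carrier
  T f g p n k = ((f · invS g p) · ((xS · invS g p) ^S k)) n

  Poly : Set c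
  Poly = ℕ → Carrier

  assocPoly : (ℕ → ℕ → Carrier) → ℕ → Poly
  assocPoly a n j = if j ≤ᵇ n then a n j else 0#

  constP : Carrier → Poly
  constP a zero    = a
  constP a (suc _) = 0#

  _+P_ : Poly → Poly → Poly
  (p +P q) j = p j + q j

  _-P_ : Poly → Poly → Poly
  (p -P q) j = p j - q j

  xP : Poly → Poly
  xP p zero    = 0#
  xP p (suc j) = p j

  -- p(x) / x  (exact division, used only on polynomials with zero constant term)
  divX : Poly → Poly
  divX p j = p (suc j)

  _≈P_ : Poly → Poly → Set ℓ
  p ≈P q = ∀ j → p j ≈ q j

module Submission where

-- Both parts of the theorem are instances of one shifting identity for the
-- matrix T(A | g).  Write h = 1/g and u = x/g = x·h, so that the k-th column
-- of T(A | g) is A·h·uᵏ.  Since u^(k+1) = x·(h·uᵏ) and multiplication by x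
-- shifts coefficients by one,
--
--     T(A | g)[n+1, k+1] = T(A·h | g)[n, k]                 (T-shift)
--
-- while the 0-th column of T(A | g) is A·h.  Taking A = f·g (so A·h = f)
-- gives part (a): the column-0 entries of T(f·g | g) are the coefficients
-- of f, and the remaining entries of row n+1 are those of row n of T(f | g).
-- Taking A = f gives part (b): T(f·h | g)[n, k] = T(f | g)[n+1, k+1], i.e.
-- r_n is p_{n+1} with its constant term removed, divided by x.

open import Defs
open import Level using (Level)
open import Data.Nat using (ℕ; suc; zero; _∸_; _≤ᵇ_) renaming (_+_ to _+ℕ_)
open import Data.Nat.Properties using () renaming (+-identityʳ to ℕ-+-identityʳ; +-suc to ℕ-+-suc)
open import Data.Bool using (true; false)
open import Data.Product using (_×_; _,_)
open import Relation.Nullary using (¬_)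
open import Relation.Binary.PropositionalEquality as ≡ using (_≡_)
import Algebra.Properties.Ring as RingProperties
import Algebra.Properties.CommutativeSemigroup as CommutativeSemigroupProperties
import Relation.Binary.Reasoning.Setoid as SetoidReasoning

module PowerSeriesFacts {c ℓ : Level} (K : Field c ℓ) where
  open Field K
  open FieldTheory K
  open RingProperties ring using (-‿distribʳ-*; -0#≈0#)
  open CommutativeSemigroupProperties +-commutativeSemigroup using (interchange)
  open SetoidReasoning setoid

  _≈S_ : PS → PS → Set ℓ
  a ≈S b = ∀ n → a n ≈ b n

  shift : PS → PS
  shift a m = a (suc m)

  _+S_ : PS → PS → PS
  (a +S b) n = a n + b n

  _•S_ : Carrier → PS → PS
  (x •S a) n = x * a n

  sumTo-cong : ∀ n {h k : ℕ → Carrier} → (∀ i → h i ≈ k i) → sumTo n h ≈ sumTo n k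
  sumTo-cong zero    e = e 0
  sumTo-cong (suc n) e = +-cong (sumTo-cong n e) (e (suc n))

  sumTo-first : ∀ n (h : ℕ → Carrier) → sumTo (suc n) h ≈ h 0 + sumTo n (λ i → h (suc i))
  sumTo-first zero    h = refl
  sumTo-first (suc n) h = begin
    sumTo (suc n) h + h (suc (suc n))                   ≈⟨ +-congʳ (sumTo-first n h) ⟩
    (h 0 + sumTo n (λ i → h (suc i))) + h (suc (suc n)) ≈⟨ +-assoc _ _ _ ⟩
    h 0 + sumTo (suc n) (λ i → h (suc i))               ∎

  sumTo-+ : ∀ n (a b : ℕ → Carrier) → sumTo n (λ i → a i + b i) ≈ sumTo n a + sumTo n b
  sumTo-+ zero    a b = refl
  sumTo-+ (suc n) a b = trans (+-congʳ (sumTo-+ n a b)) (interchange _ _ _ _)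

  sumTo-*ˡ : ∀ n x (a : ℕ → Carrier) → sumTo n (λ i → x * a i) ≈ x * sumTo n a
  sumTo-*ˡ zero    x a = refl
  sumTo-*ˡ (suc n) x a = trans (+-congʳ (sumTo-*ˡ n x a)) (sym (distribˡ _ _ _))

  sumTo-zero : ∀ n → sumTo n (λ _ → 0#) ≈ 0#
  sumTo-zero zero    = refl
  sumTo-zero (suc n) = trans (+-congʳ (sumTo-zero n)) (+-identityˡ _)

  ·-congˡ : ∀ {a a'} b → a ≈S a' → (a · b) ≈S (a' · b)
  ·-congˡ b e n = sumTo-cong n (λ i → *-congʳ (e i))

  ·-congʳ : ∀ a {b b'} → b ≈S b' → (a · b) ≈S (a · b')
  ·-congʳ a e n = sumTo-cong n (λ i → *-congˡ (e (n ∸ i)))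

  -- The recursion behind every inductive argument below:
  -- a·b = a₀·b + x·(shift a · b).
  ·-suc : ∀ a b n → (a · b) (suc n) ≈ a 0 * b (suc n) + (shift a · b) n
  ·-suc a b n = sumTo-first n (λ i → a i * b (suc n ∸ i))

  ·-distribʳ : ∀ a b c n → ((a +S b) · c) n ≈ (a · c) n + (b · c) n
  ·-distribʳ a b c n = trans (sumTo-cong n (λ i → distribʳ _ _ _)) (sumTo-+ n _ _)

  ·-scalarˡ : ∀ x a c n → ((x •S a) · c) n ≈ x * (a · c) n
  ·-scalarˡ x a c n = trans (sumTo-cong n (λ i → *-assoc _ _ _)) (sumTo-*ˡ n x _)

  ·-assoc : ∀ a b c n → ((a · b) · c) n ≈ (a · (b · c)) n
  ·-assoc a b c zero    = *-assoc _ _ _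
  ·-assoc a b c (suc n) = begin
    ((a · b) · c) (suc n)                                       ≈⟨ ·-suc (a · b) c n ⟩
    (a 0 * b 0) * c (suc n) + (shift (a · b) · c) n             ≈⟨ +-congˡ shift-ab ⟩
    (a 0 * b 0) * c (suc n) + (a 0 * (shift b · c) n + (shift a · (b · c)) n)
                                                                ≈⟨ sym (+-assoc _ _ _) ⟩
    ((a 0 * b 0) * c (suc n) + a 0 * (shift b · c) n) + (shift a · (b · c)) n
                                                                ≈⟨ +-congʳ factor-a₀ ⟩
    a 0 * (b · c) (suc n) + (shift a · (b · c)) n               ≈⟨ sym (·-suc a (b · c) n) ⟩
    (a · (b · c)) (suc n)                                       ∎
    where
    -- shift (a·b) = a₀ • shift b + shift a · b, then distribute and recurse.
    shift-ab : (shift (a · b) · c) n ≈ a 0 * (shift b · c) n + (shift a · (b · c)) n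
    shift-ab = begin
      (shift (a · b) · c) n                              ≈⟨ ·-congˡ c (·-suc a b) n ⟩
      (((a 0 •S shift b) +S (shift a · b)) · c) n        ≈⟨ ·-distribʳ _ _ c n ⟩
      ((a 0 •S shift b) · c) n + ((shift a · b) · c) n   ≈⟨ +-cong (·-scalarˡ _ _ c n) (·-assoc (shift a) b c n) ⟩
      a 0 * (shift b · c) n + (shift a · (b · c)) n      ∎
    factor-a₀ : (a 0 * b 0) * c (suc n) + a 0 * (shift b · c) n ≈ a 0 * (b · c) (suc n)
    factor-a₀ = begin
      (a 0 * b 0) * c (suc n) + a 0 * (shift b · c) n    ≈⟨ +-congʳ (*-assoc _ _ _) ⟩
      a 0 * (b 0 * c (suc n)) + a 0 * (shift b · c) n    ≈⟨ sym (distribˡ _ _ _) ⟩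
      a 0 * (b 0 * c (suc n) + (shift b · c) n)          ≈⟨ *-congˡ (sym (·-suc b c n)) ⟩
      a 0 * (b · c) (suc n)                              ∎

  ·-identityʳ : ∀ a n → (a · oneS) n ≈ a n
  ·-identityʳ a zero    = *-identityʳ _
  ·-identityʳ a (suc n) = begin
    (a · oneS) (suc n)                        ≈⟨ ·-suc a oneS n ⟩
    a 0 * 0# + (shift a · oneS) n             ≈⟨ +-cong (zeroʳ _) (·-identityʳ (shift a) n) ⟩
    0# + a (suc n)                            ≈⟨ +-identityˡ _ ⟩
    a (suc n)                                 ∎

  ·-identityˡ : ∀ b n → (oneS · b) n ≈ b n
  ·-identityˡ b zero    = *-identityˡ _
  ·-identityˡ b (suc n) = begin
    (oneS · b) (suc n)                                    ≈⟨ sumTo-first n _ ⟩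
    1# * b (suc n) + sumTo n (λ i → 0# * b (n ∸ i))       ≈⟨ +-cong (*-identityˡ _) (sumTo-cong n (λ _ → zeroˡ _)) ⟩
    b (suc n) + sumTo n (λ _ → 0#)                        ≈⟨ +-congˡ (sumTo-zero n) ⟩
    b (suc n) + 0#                                        ≈⟨ +-identityʳ _ ⟩
    b (suc n)                                             ∎

  shift-xS : shift xS ≈S oneS
  shift-xS zero    = refl
  shift-xS (suc _) = refl

  xS·-zero : ∀ b → (xS · b) 0 ≈ 0#
  xS·-zero b = zeroˡ _

  xS·-suc : ∀ b m → (xS · b) (suc m) ≈ b m
  xS·-suc b m = begin
    (xS · b) (suc m)                  ≈⟨ ·-suc xS b m ⟩
    0# * b (suc m) + (shift xS · b) m ≈⟨ +-cong (zeroˡ _) (·-congˡ b shift-xS m) ⟩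
    0# + (oneS · b) m                 ≈⟨ +-identityˡ _ ⟩
    (oneS · b) m                      ≈⟨ ·-identityˡ b m ⟩
    b m                               ∎

  ·-xS-shift : ∀ a b n → (a · (xS · b)) (suc n) ≈ (a · b) n
  ·-xS-shift a b zero = begin
    (a · (xS · b)) 1                                ≈⟨ ·-suc a (xS · b) 0 ⟩
    a 0 * (xS · b) 1 + a 1 * (xS · b) 0             ≈⟨ +-cong (*-congˡ (xS·-suc b 0)) (*-congˡ (xS·-zero b)) ⟩
    a 0 * b 0 + a 1 * 0#                            ≈⟨ +-congˡ (zeroʳ _) ⟩
    a 0 * b 0 + 0#                                  ≈⟨ +-identityʳ _ ⟩
    (a · b) 0                                       ∎
  ·-xS-shift a b (suc n) = begin
    (a · (xS · b)) (suc (suc n))                              ≈⟨ ·-suc a (xS · b) (suc n) ⟩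
    a 0 * (xS · b) (suc (suc n)) + (shift a · (xS · b)) (suc n)
                                                ≈⟨ +-cong (*-congˡ (xS·-suc b (suc n))) (·-xS-shift (shift a) b n) ⟩
    a 0 * b (suc n) + (shift a · b) n                         ≈⟨ sym (·-suc a b n) ⟩
    (a · b) (suc n)                                           ∎

  module Inverse (g : PS) (g0 : ¬ (g 0 ≈ 0#)) where
    h : PS
    h = invS g g0

    dot-invUpTo : ∀ n m → dot g m (invUpTo g g0 n) ≈ sumTo n (λ i → g (m +ℕ i) * h (n ∸ i))
    dot-invUpTo zero m = trans (+-identityʳ _) (*-congʳ (reflexive (≡.cong g (≡.sym (ℕ-+-identityʳ m)))))
    dot-invUpTo (suc n) m = begin
      g m * h (suc n) + dot g (suc m) (invUpTo g g0 n)
        ≈⟨ +-cong (*-congʳ (reflexive (≡.cong g (≡.sym (ℕ-+-identityʳ m))))) (dot-invUpTo n (suc m)) ⟩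
      g (m +ℕ 0) * h (suc n) + sumTo n (λ i → g (suc m +ℕ i) * h (n ∸ i))
        ≈⟨ +-congˡ (sumTo-cong n (λ i → *-congʳ (reflexive (≡.cong g (≡.sym (ℕ-+-suc m i)))))) ⟩
      g (m +ℕ 0) * h (suc n) + sumTo n (λ i → g (m +ℕ suc i) * h (n ∸ i))
        ≈⟨ sym (sumTo-first n _) ⟩
      sumTo (suc n) (λ i → g (m +ℕ i) * h (suc n ∸ i)) ∎

    g·h≈1 : (g · h) ≈S oneS
    g·h≈1 zero    = inv-r (g 0) g0
    g·h≈1 (suc n) = begin
      (g · h) (suc n)            ≈⟨ ·-suc g h n ⟩
      g 0 * h (suc n) + D        ≈⟨ +-congʳ (sym (-‿distribʳ-* _ _)) ⟩
      - (g 0 * (g₀⁻¹ * D')) + D  ≈⟨ +-congʳ (-‿cong (sym (*-assoc _ _ _))) ⟩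
      - ((g 0 * g₀⁻¹) * D') + D  ≈⟨ +-congʳ (-‿cong (trans (*-congʳ (inv-r (g 0) g0)) (*-identityˡ _))) ⟩
      - D' + D                   ≈⟨ +-congʳ (-‿cong (dot-invUpTo n 1)) ⟩
      - D + D                    ≈⟨ -‿inverseˡ _ ⟩
      0#                         ∎
      where
      g₀⁻¹ = inv (g 0) g0
      D    = (shift g · h) n
      D'   = dot g 1 (invUpTo g g0 n)

    cancel-g : ∀ A → ((A · g) · h) ≈S A
    cancel-g A n = begin
      ((A · g) · h) n  ≈⟨ ·-assoc A g h n ⟩
      (A · (g · h)) n  ≈⟨ ·-congʳ A g·h≈1 n ⟩
      (A · oneS) n     ≈⟨ ·-identityʳ A n ⟩
      A n              ∎

    T-cong : ∀ {A A'} → A ≈S A' → ∀ n k → T A g g0 n k ≈ T A' g g0 n k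
    T-cong e n k = ·-congˡ ((xS · h) ^S k) (·-congˡ h e) n

    T-column₀ : ∀ A n → T A g g0 n 0 ≈ (A · h) n
    T-column₀ A n = ·-identityʳ (A · h) n

    T-shift : ∀ A n k → T A g g0 (suc n) (suc k) ≈ T (A · h) g g0 n k
    T-shift A n k = begin
      ((A · h) · ((xS · h) · uᵏ)) (suc n)  ≈⟨ ·-congʳ (A · h) (·-assoc xS h uᵏ) (suc n) ⟩
      ((A · h) · (xS · (h · uᵏ))) (suc n)  ≈⟨ ·-xS-shift (A · h) (h · uᵏ) n ⟩
      ((A · h) · (h · uᵏ)) n               ≈⟨ sym (·-assoc (A · h) h uᵏ n) ⟩
      (((A · h) · h) · uᵏ) n               ∎
      where
      uᵏ = (xS · h) ^S k

  ≤ᵇ-suc : ∀ j n → (suc j ≤ᵇ suc n) ≡ (j ≤ᵇ n)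
  ≤ᵇ-suc zero    n = ≡.refl
  ≤ᵇ-suc (suc j) n = ≡.refl

  assocPoly-shift : ∀ (a b : ℕ → ℕ → Carrier) → (∀ n j → a (suc n) (suc j) ≈ b n j) →
                    ∀ n j → assocPoly a (suc n) (suc j) ≈ assocPoly b n j
  assocPoly-shift a b e n j rewrite ≤ᵇ-suc j n with j ≤ᵇ n
  ... | true  = e n j
  ... | false = refl

  theorem : (f g : PS) (g0 : ¬ (g 0 ≈ 0#)) →
    let p = assocPoly (T f g g0)
        q = assocPoly (T (f · g) g g0)
        r = assocPoly (T (f · invS g g0) g g0)
    in (q 0 ≈P constP (f 0) × (∀ (n : ℕ) → q (suc n) ≈P (xP (p n) +P constP (f (suc n)))))
       × (∀ (n : ℕ) → r n ≈P divX (p (suc n) -P constP (p (suc n) 0)))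
  theorem f g g0 = (q₀ , q-suc) , r-shift
    where
    open Inverse g g0
    q-column₀ : ∀ n → T (f · g) g g0 n 0 ≈ f n
    q-column₀ n = trans (T-column₀ (f · g) n) (cancel-g f n)

    q₀ : assocPoly (T (f · g) g g0) 0 ≈P constP (f 0)
    q₀ zero    = q-column₀ 0
    q₀ (suc j) = refl

    q-suc : ∀ n → assocPoly (T (f · g) g g0) (suc n)
                    ≈P (xP (assocPoly (T f g g0) n) +P constP (f (suc n)))
    q-suc n zero    = trans (q-column₀ (suc n)) (sym (+-identityˡ _))
    q-suc n (suc j) = trans (assocPoly-shift (T (f · g) g g0) (T f g g0) q-entry n j) (sym (+-identityʳ _))
      where
      q-entry : ∀ m k → T (f · g) g g0 (suc m) (suc k) ≈ T f g g0 m k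
      q-entry m k = trans (T-shift (f · g) m k) (T-cong (cancel-g f) m k)

    r-shift : ∀ n → assocPoly (T (f · h) g g0) n
                      ≈P divX (assocPoly (T f g g0) (suc n) -P constP (assocPoly (T f g g0) (suc n) 0))
    r-shift n j = begin
      assocPoly (T (f · h) g g0) n j              ≈⟨ sym (assocPoly-shift (T f g g0) (T (f · h) g g0) (T-shift f) n j) ⟩
      assocPoly (T f g g0) (suc n) (suc j)        ≈⟨ sym (+-identityʳ _) ⟩
      assocPoly (T f g g0) (suc n) (suc j) + 0#   ≈⟨ +-congˡ (sym -0#≈0#) ⟩
      assocPoly (T f g g0) (suc n) (suc j) - 0#   ∎

mainTheorem5 : {c ℓ : Level} (K : Field c ℓ) → let open Field K in let open FieldTheory K in
    CharZero → (f g : PS) → ¬ (f 0 ≈ 0#) → (g0 : ¬ (g 0 ≈ 0#)) →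
    let p = assocPoly (T f g g0)
        q = assocPoly (T (f · g) g g0)
        r = assocPoly (T (f · invS g g0) g g0)
    in (q 0 ≈P constP (f 0) × (∀ (n : ℕ) → q (suc n) ≈P (xP (p n) +P constP (f (suc n)))))
       × (∀ (n : ℕ) → r n ≈P divX (p (suc n) -P constP (p (suc n) 0)))
mainTheorem5 K _ f g _ g0 = PowerSeriesFacts.theorem K f g g0
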